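{- Let $D$ be a finite twin-free digraph. Then $\overrightarrow{\gamma^{\mathrm{ID}}}(D)=|V(D)|$ if and only if $\overrightarrow{\gamma^{\mathrm{S}}}(D)=|V(D)|-1$ and, for every separating code $C$ of $D$ of minimum size, there is a vertex $u$ of $D$ with $B_1^+(u)\cap C=\emptyset$.
   Context: Digraphs have no loops or multiple arcs. For a vertex $u$ of a digraph $D$, $B_1^+(u)$ is the set consisting of $u$ and all vertices $w$ with an arc from $w$ to $u$. Two vertices $u\neq v$ are twins if $B_1^+(u)=B_1^+(v)$; $D$ is twin-free if it has no twins. A separating code is a set $C\subseteq V(D)$ with $B_1^+(u)\cap C\neq B_1^+(v)\cap C$ for all distinct $u,v$; a dominating set is a set $C$ with $B_1^+(u)\cap C\neq\emptyset$ for all $u$; an identifying code is a set that is both. $\overrightarrow{\gamma^{\mathrm{S}}}(D)$ and $\overrightarrow{\gamma^{\mathrm{ID}}}(D)$ denote the minimum sizes of a separating code and of an identifying code of $D$. -}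

module Defs where

open import Data.Nat using (ℕ; _≤_)
open import Data.Bool using (Bool; true; false; _∨_)
open import Data.Fin using (Fin; _≟_)
open import Data.Fin.Subset using (Subset; _∩_; ⊥; ∣_∣)
open import Data.Vec using (tabulate)
open import Data.Product using (_×_; ∃)
open import Relation.Binary.PropositionalEquality using (_≡_; _≢_)
open import Relation.Nullary.Decidable using (⌊_⌋)

-- A finite digraph on vertex set Fin n: arc u v = true iff there is an arc u → v.
-- No loops; multiple arcs are impossible in this representation.
record Digraph (n : ℕ) : Set where
  field
    arc    : Fin n → Fin n → Bool
    noLoop : ∀ u → arc u u ≡ false
open Digraph public

B₁⁺ : ∀ {n} → Digraph n → Fin n → Subset n
B₁⁺ D u = tabulate (λ w → ⌊ w ≟ u ⌋ ∨ arc D w u)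

TwinFree : ∀ {n} → Digraph n → Set
TwinFree D = ∀ u v → u ≢ v → B₁⁺ D u ≢ B₁⁺ D v

IsSeparating : ∀ {n} → Digraph n → Subset n → Set
IsSeparating D C = ∀ u v → u ≢ v → B₁⁺ D u ∩ C ≢ B₁⁺ D v ∩ C

IsDominating : ∀ {n} → Digraph n → Subset n → Set
IsDominating D C = ∀ u → B₁⁺ D u ∩ C ≢ ⊥

IsIdentifying : ∀ {n} → Digraph n → Subset n → Set
IsIdentifying D C = IsSeparating D C × IsDominating D C

IsMinSeparating : ∀ {n} → Digraph n → Subset n → Set
IsMinSeparating D C = IsSeparating D C × (∀ C' → IsSeparating D C' → ∣ C ∣ ≤ ∣ C' ∣)

IsMinIdentifying : ∀ {n} → Digraph n → Subset n → Set
IsMinIdentifying D C = IsIdentifying D C × (∀ C' → IsIdentifying D C' → ∣ C ∣ ≤ ∣ C' ∣)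

γS≡ : ∀ {n} → Digraph n → ℕ → Set
γS≡ D k = ∃ (λ C → IsMinSeparating D C × ∣ C ∣ ≡ k)

γID≡ : ∀ {n} → Digraph n → ℕ → Set
γID≡ D k = ∃ (λ C → IsMinIdentifying D C × ∣ C ∣ ≡ k)

-- The n + 1 closed in-neighbourhoods of a twin-free digraph are distinct, and any k + 1
-- distinct sets stay distinct on some k points: add the sets one at a time; a new set
-- collides with at most one earlier trace (the earlier traces being distinct), and one
-- point where the two sets differ separates them.  Hence γS ≤ n.  Adding an undominated
-- vertex to a separating code makes it identifying, so γID ≤ γS + 1, and γID ≤ γS as soon
-- as some minimum separating code dominates.  Since V(D) itself identifies, both
-- directions follow by comparing these bounds with n + 1.
module Submission where

open import Defs
open import Data.Nat using (ℕ; suc; zero; _≤_; _<_; _+_; s≤s)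
open import Data.Nat.Properties
  using (≤-refl; ≤-reflexive; ≤-trans; ≤-antisym; ≤-pred; n≤1+n; m≤n⇒m≤1+n; +-suc; +-comm;
         +-monoʳ-≤; <⇒≱; ≰⇒>; _≤?_)
open import Data.Bool using (true; false; _∧_; _∨_)
import Data.Bool as Bool
open import Data.Bool.Properties using (∧-identityʳ; T-≡)
open import Data.Fin using (Fin; _≟_)
import Data.Fin as Fin
open import Data.Fin.Properties using (any?; ¬∀⟶∃¬; suc-injective; 0≢1+n)
open import Data.Fin.Subset using (Subset; _∈_; _∩_; _∪_; ⊥; ⊤; ⁅_⁆; ∣_∣)
open import Data.Fin.Subset.Properties
  using (∩-assoc; ∩-comm; ∩-abs-∪; ∩-zeroˡ; ∩-identityʳ; ∣⊤∣≡n; ∣⊥∣≡0; ∣⁅x⁆∣≡1; ∣p∣≤∣x∷p∣;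
         ∉⊥; ∈⊤; x∈⁅x⁆; x∈p∩q⁺; x∈p∪q⁺)
open import Data.Vec using ([]; _∷_; lookup)
open import Data.Vec.Properties
  using (≡-dec; lookup-zipWith; lookup∘tabulate; tabulate∘lookup; tabulate-cong; []=⇒lookup;
         lookup⇒[]=)
open import Data.Product using (_×_; ∃; _,_; uncurry)
open import Data.Sum using (inj₂)
open import Data.Empty using (⊥-elim)
open import Function using (_∘_)
open import Function.Bundles using (_⇔_; mk⇔; Equivalence)
open import Function.Definitions using (Injective)
open import Relation.Binary.Definitions using (DecidableEquality)
open import Relation.Nullary using (Dec; yes; no)
open import Relation.Nullary.Decidable using (⌊_⌋; fromWitness)
open import Relation.Binary.PropositionalEquality
  using (_≡_; _≢_; refl; sym; trans; cong; subst; module ≡-Reasoning)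

≢-preserving⇒injective : ∀ {a b} {A : Set a} {B : Set b} {f : A → B} → DecidableEquality A →
                         (∀ u v → u ≢ v → f u ≢ f v) → Injective _≡_ _≡_ f
≢-preserving⇒injective _≟ᴬ_ preserves {u} {v} fu≡fv with u ≟ᴬ v
... | yes u≡v = u≡v
... | no  u≢v = ⊥-elim (preserves u v u≢v fu≡fv)

module _ {m : ℕ} where

  ≢⇒∃lookup≢ : {p q : Subset m} → p ≢ q → ∃ λ x → lookup p x ≢ lookup q x
  ≢⇒∃lookup≢ {p} {q} p≢q = ¬∀⟶∃¬ m _ (λ x → lookup p x Bool.≟ lookup q x) (p≢q ∘ lookup-ext)
    where
    lookup-ext : (∀ x → lookup p x ≡ lookup q x) → p ≡ q
    lookup-ext eq = trans (sym (tabulate∘lookup p)) (trans (tabulate-cong eq) (tabulate∘lookup q))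

  lookup-∩-∈ : ∀ (p : Subset m) {t x} → x ∈ t → lookup (p ∩ t) x ≡ lookup p x
  lookup-∩-∈ p {t} {x} x∈t = begin
    lookup (p ∩ t) x         ≡⟨ lookup-zipWith _∧_ x p t ⟩
    lookup p x ∧ lookup t x  ≡⟨ cong (lookup p x ∧_) ([]=⇒lookup x∈t) ⟩
    lookup p x ∧ true        ≡⟨ ∧-identityʳ (lookup p x) ⟩
    lookup p x               ∎
    where open ≡-Reasoning

  ∈∧lookup≢⇒∩≢ : ∀ {p q t : Subset m} {x} → x ∈ t → lookup p x ≢ lookup q x → p ∩ t ≢ q ∩ t
  ∈∧lookup≢⇒∩≢ {p} {q} {t} {x} x∈t differ p∩t≡q∩t =
    differ (trans (sym (lookup-∩-∈ p x∈t)) (trans (cong (λ s → lookup s x) p∩t≡q∩t) (lookup-∩-∈ q x∈t)))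

  p∩t≡p∩[t∪s]∩t : ∀ (p t s : Subset m) → p ∩ t ≡ (p ∩ (t ∪ s)) ∩ t
  p∩t≡p∩[t∪s]∩t p t s = begin
    p ∩ t                ≡⟨ cong (p ∩_) (sym (∩-abs-∪ t s)) ⟩
    p ∩ (t ∩ (t ∪ s))    ≡⟨ cong (p ∩_) (∩-comm t (t ∪ s)) ⟩
    p ∩ ((t ∪ s) ∩ t)    ≡⟨ sym (∩-assoc p (t ∪ s) t) ⟩
    (p ∩ (t ∪ s)) ∩ t    ∎
    where open ≡-Reasoning

  ∩-∪-restrict : ∀ {p q : Subset m} t s → p ∩ (t ∪ s) ≡ q ∩ (t ∪ s) → p ∩ t ≡ q ∩ t
  ∩-∪-restrict {p} {q} t s eq = begin
    p ∩ t                ≡⟨ p∩t≡p∩[t∪s]∩t p t s ⟩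
    (p ∩ (t ∪ s)) ∩ t    ≡⟨ cong (_∩ t) eq ⟩
    (q ∩ (t ∪ s)) ∩ t    ≡⟨ sym (p∩t≡p∩[t∪s]∩t q t s) ⟩
    q ∩ t                ∎
    where open ≡-Reasoning

∣p∪q∣≤∣p∣+∣q∣ : ∀ {m} (p q : Subset m) → ∣ p ∪ q ∣ ≤ ∣ p ∣ + ∣ q ∣
∣p∪q∣≤∣p∣+∣q∣ [] [] = ≤-refl
∣p∪q∣≤∣p∣+∣q∣ (true  ∷ p) (b ∷ q) =
  s≤s (≤-trans (∣p∪q∣≤∣p∣+∣q∣ p q) (+-monoʳ-≤ ∣ p ∣ (∣p∣≤∣x∷p∣ b q)))
∣p∪q∣≤∣p∣+∣q∣ (false ∷ p) (true  ∷ q) =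
  ≤-trans (s≤s (∣p∪q∣≤∣p∣+∣q∣ p q)) (≤-reflexive (sym (+-suc ∣ p ∣ ∣ q ∣)))
∣p∪q∣≤∣p∣+∣q∣ (false ∷ p) (false ∷ q) = ∣p∪q∣≤∣p∣+∣q∣ p q

∣p∪⁅x⁆∣≤1+∣p∣ : ∀ {m} (p : Subset m) x → ∣ p ∪ ⁅ x ⁆ ∣ ≤ suc ∣ p ∣
∣p∪⁅x⁆∣≤1+∣p∣ p x = ≤-trans (∣p∪q∣≤∣p∣+∣q∣ p ⁅ x ⁆)
  (≤-reflexive (trans (cong (∣ p ∣ +_) (∣⁅x⁆∣≡1 x)) (+-comm ∣ p ∣ 1)))

_≟ˢ_ : ∀ {m} → DecidableEquality (Subset m)
_≟ˢ_ = ≡-dec Bool._≟_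

Separates : ∀ {k m} → Subset m → (Fin k → Subset m) → Set
Separates t B = Injective _≡_ _≡_ (λ u → B u ∩ t)

∃-separator : ∀ {k m} (B : Fin (suc k) → Subset m) → Injective _≡_ _≡_ B →
              ∃ λ t → Separates t B × ∣ t ∣ ≤ k
∃-separator {zero} {m} B _ = ⊥ , (λ { {Fin.zero} {Fin.zero} _ → refl }) , ≤-reflexive (∣⊥∣≡0 m)
∃-separator {suc k} B B-inj
  with ∃-separator (B ∘ Fin.suc) (suc-injective ∘ B-inj)
... | t , t-sep , ∣t∣≤k
  with any? (λ v → (B Fin.zero ∩ t) ≟ˢ (B (Fin.suc v) ∩ t))
... | no fresh = t , sep , m≤n⇒m≤1+n ∣t∣≤k
  where
  sep : Separates t B
  sep {Fin.zero}  {Fin.zero}  _  = refl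
  sep {Fin.zero}  {Fin.suc v} eq = ⊥-elim (fresh (v , eq))
  sep {Fin.suc u} {Fin.zero}  eq = ⊥-elim (fresh (u , sym eq))
  sep {Fin.suc u} {Fin.suc v} eq = cong Fin.suc (t-sep eq)
... | yes (v₀ , collision) with ≢⇒∃lookup≢ (0≢1+n ∘ B-inj {Fin.zero} {Fin.suc v₀})
... | x , differ = t ∪ ⁅ x ⁆ , sep , ≤-trans (∣p∪⁅x⁆∣≤1+∣p∣ t x) (s≤s ∣t∣≤k)
  where
  x∈t′ : x ∈ t ∪ ⁅ x ⁆
  x∈t′ = x∈p∪q⁺ (inj₂ (x∈⁅x⁆ x))

  zero-separated : ∀ v → B Fin.zero ∩ (t ∪ ⁅ x ⁆) ≢ B (Fin.suc v) ∩ (t ∪ ⁅ x ⁆)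
  zero-separated v eq with t-sep (trans (sym collision) (∩-∪-restrict t ⁅ x ⁆ eq))
  ... | refl = ∈∧lookup≢⇒∩≢ x∈t′ differ eq

  sep : Separates (t ∪ ⁅ x ⁆) B
  sep {Fin.zero}  {Fin.zero}  _  = refl
  sep {Fin.zero}  {Fin.suc v} eq = ⊥-elim (zero-separated v eq)
  sep {Fin.suc u} {Fin.zero}  eq = ⊥-elim (zero-separated u (sym eq))
  sep {Fin.suc u} {Fin.suc v} eq = cong Fin.suc (t-sep (∩-∪-restrict t ⁅ x ⁆ eq))

module _ {N : ℕ} (D : Digraph N) where

  HasUndominated : Subset N → Set
  HasUndominated C = ∃ λ u → B₁⁺ D u ∩ C ≡ ⊥

  undominated? : ∀ C → Dec (HasUndominated C)
  undominated? C = any? (λ u → (B₁⁺ D u ∩ C) ≟ˢ ⊥)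

  u∈B₁⁺u : ∀ u → u ∈ B₁⁺ D u
  u∈B₁⁺u u = lookup⇒[]= u (B₁⁺ D u) (begin
    lookup (B₁⁺ D u) u             ≡⟨ lookup∘tabulate (λ w → ⌊ w ≟ u ⌋ ∨ arc D w u) u ⟩
    ⌊ u ≟ u ⌋ ∨ arc D u u          ≡⟨ cong (_∨ arc D u u) (Equivalence.to T-≡ (fromWitness refl)) ⟩
    true                           ∎)
    where open ≡-Reasoning

  ⊤-isIdentifying : TwinFree D → IsIdentifying D ⊤
  ⊤-isIdentifying twinFree = separating , dominating
    where
    separating : IsSeparating D ⊤
    separating u v u≢v eq =
      twinFree u v u≢v (trans (sym (∩-identityʳ _)) (trans eq (∩-identityʳ _)))
    dominating : IsDominating D ⊤
    dominating u eq = ∉⊥ (subst (u ∈_) eq (x∈p∩q⁺ (u∈B₁⁺u u , ∈⊤)))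

  separating∪undominated-isIdentifying : ∀ {C u} → IsSeparating D C → B₁⁺ D u ∩ C ≡ ⊥ →
                                         IsIdentifying D (C ∪ ⁅ u ⁆)
  separating∪undominated-isIdentifying {C} {u} C-sep u-undom = separating , dominating
    where
    separating : IsSeparating D (C ∪ ⁅ u ⁆)
    separating v w v≢w eq = C-sep v w v≢w (∩-∪-restrict C ⁅ u ⁆ eq)
    dominating : IsDominating D (C ∪ ⁅ u ⁆)
    dominating v eq with ≢-preserving⇒injective _≟_ C-sep {v} {u} v∩C≡u∩C
      where
      v∩C≡u∩C : B₁⁺ D v ∩ C ≡ B₁⁺ D u ∩ C
      v∩C≡u∩C = trans (∩-∪-restrict C ⁅ u ⁆ (trans eq (sym (∩-zeroˡ _))))
                      (trans (∩-zeroˡ C) (sym u-undom))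
    ... | refl = ∉⊥ (subst (u ∈_) eq (x∈p∩q⁺ (u∈B₁⁺u u , x∈p∪q⁺ (inj₂ (x∈⁅x⁆ u)))))

  minIdentifying≤1+separating : ∀ {C₀ C} → IsMinIdentifying D C₀ → IsSeparating D C →
                                ∣ C₀ ∣ ≤ suc ∣ C ∣
  minIdentifying≤1+separating {C = C} (_ , C₀-least) C-sep with undominated? C
  ... | yes (u , u-undom) = ≤-trans (C₀-least _ (separating∪undominated-isIdentifying C-sep u-undom))
                                    (∣p∪⁅x⁆∣≤1+∣p∣ C u)
  ... | no  none = ≤-trans (C₀-least C (C-sep , λ u eq → none (u , eq))) (n≤1+n ∣ C ∣)

  separating<minIdentifying⇒undominated : ∀ {C₀ C} → IsMinIdentifying D C₀ → IsSeparating D C →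
                                           ∣ C ∣ < ∣ C₀ ∣ → HasUndominated C
  separating<minIdentifying⇒undominated {C = C} (_ , C₀-least) C-sep ∣C∣<∣C₀∣ with undominated? C
  ... | yes undominated = undominated
  ... | no  none = ⊥-elim (<⇒≱ ∣C∣<∣C₀∣ (C₀-least C (C-sep , λ u eq → none (u , eq))))

  1+minSeparating≤identifying : ∀ {T C} → IsMinSeparating D T →
                                (∀ C′ → IsMinSeparating D C′ → HasUndominated C′) →
                                IsIdentifying D C → suc ∣ T ∣ ≤ ∣ C ∣
  1+minSeparating≤identifying {T} {C} (_ , T-least) minSeparating⇒undominated (C-sep , C-dom)
    with ∣ C ∣ ≤? ∣ T ∣
  ... | no  ∣C∣≰∣T∣ = ≰⇒> ∣C∣≰∣T∣
  ... | yes ∣C∣≤∣T∣ = ⊥-elim (uncurry C-dom (minSeparating⇒undominated C C-min))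
    where
    C-min : IsMinSeparating D C
    C-min = C-sep , λ C′ C′-sep → ≤-trans ∣C∣≤∣T∣ (T-least C′ C′-sep)

twinFree⇒smallSeparating : ∀ {n} (D : Digraph (suc n)) → TwinFree D →
                           ∃ λ T → IsSeparating D T × ∣ T ∣ ≤ n
twinFree⇒smallSeparating D twinFree with ∃-separator (B₁⁺ D) (≢-preserving⇒injective _≟_ twinFree)
... | T , T-sep , ∣T∣≤n = T , (λ _ _ u≢v → u≢v ∘ T-sep) , ∣T∣≤n

proposition4 : (n : ℕ) (D : Digraph (suc n)) → TwinFree D →
    (γID≡ D (suc n) ⇔
      (γS≡ D n × (∀ (C : Subset (suc n)) → IsMinSeparating D C → ∃ λ u → B₁⁺ D u ∩ C ≡ ⊥)))
proposition4 n D twinFree with twinFree⇒smallSeparating D twinFree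
... | T , T-sep , ∣T∣≤n = mk⇔ fwd bwd
  where
  fwd : γID≡ D (suc n) → γS≡ D n × (∀ C → IsMinSeparating D C → HasUndominated D C)
  fwd (C₀ , C₀-min , ∣C₀∣≡1+n) = (T , T-min , ≤-antisym ∣T∣≤n (n≤separating T-sep)) , undominated
    where
    n≤separating : ∀ {C} → IsSeparating D C → n ≤ ∣ C ∣
    n≤separating C-sep =
      ≤-pred (subst (_≤ _) ∣C₀∣≡1+n (minIdentifying≤1+separating D C₀-min C-sep))

    T-min : IsMinSeparating D T
    T-min = T-sep , λ _ C-sep → ≤-trans ∣T∣≤n (n≤separating C-sep)

    undominated : ∀ C → IsMinSeparating D C → HasUndominated D C
    undominated C (C-sep , C-least) = separating<minIdentifying⇒undominated D C₀-min C-sep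
      (≤-trans (s≤s (≤-trans (C-least T T-sep) ∣T∣≤n)) (≤-reflexive (sym ∣C₀∣≡1+n)))

  bwd : γS≡ D n × (∀ C → IsMinSeparating D C → HasUndominated D C) → γID≡ D (suc n)
  bwd ((T′ , T′-min , ∣T′∣≡n) , undominated) =
    ⊤ , (⊤-isIdentifying D twinFree , ⊤-least) , ∣⊤∣≡n (suc n)
    where
    ⊤-least : ∀ C → IsIdentifying D C → ∣ ⊤ {suc n} ∣ ≤ ∣ C ∣
    ⊤-least C C-id = subst (_≤ ∣ C ∣) (trans (cong suc ∣T′∣≡n) (sym (∣⊤∣≡n (suc n))))
      (1+minSeparating≤identifying D T′-min undominated C-id)
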